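{- Let $S$, $S_1$, $S_2$ be systems. If $S_1$ is right-generated by $S$ and $S_2$ is left-generated by $S$, then $S_1=S_2$.
   Context: Work in a two-sorted first-order theory with equality whose sorts are words (lower-case variables) and systems (upper-case variables), with two word constants $0$ and $1$, a binary concatenation operation on words written by juxtaposition, and a membership relation $x\in S$ between a word and a system. Axioms: (symbols) $0\neq 1$ and $xy\neq 0$, $xy\neq 1$ for all words $x,y$; (associativity) $(xy)z=x(yz)$; (reading) $x0\neq y1$ for all $x,y$; (simplification) if $x_1y_1=x_2y_2$ and $y_1=y_2$ then $x_1=x_2$; (extensionality) two systems with the same elements are equal; (word induction) every system containing $0$ and $1$ and containing $x0$ and $x1$ whenever it contains $x$ contains every word; (comprehension) for every formula $\phi(x,x_1,\dots,x_n,S_1,\dots,S_m)$ in which $S$ is not free, there is a system $S$ with $x\in S\Leftrightarrow\phi$ for all words $x$. $S_1$ is right-generated by $S$ if $S_1$ is the smallest system (with respect to inclusion) containing every element of $S$ and such that $x_2x_1\in S_1$ for all $x_1\in S$, $x_2\in S_1$. $S_2$ is left-generated by $S$ if $S_2$ is the smallest system containing every element of $S$ and such that $x_1x_2\in S_2$ for all $x_1\in S$, $x_2\in S_2$. -}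

module Defs where

open import Data.Nat using (ℕ; zero; suc)
open import Data.Empty using (⊥)
open import Data.Unit using (⊤)
open import Data.Product using (Σ; _×_)
open import Data.Sum using (_⊎_)
open import Relation.Binary.PropositionalEquality using (_≡_)
open import Relation.Nullary using (¬_)

-- Environments (de Bruijn): variable 0 is the most recently bound one.
_∷ᵉ_ : {A : Set} → A → (ℕ → A) → ℕ → A
(a ∷ᵉ ρ) zero    = a
(a ∷ᵉ ρ) (suc n) = ρ n

data WTerm : Set where
  wvar : ℕ → WTerm
  c0 c1 : WTerm
  _·ᵗ_ : WTerm → WTerm → WTerm

-- Formulas; system variables are `ℕ` indices into a separate environment.
data Formula : Set where
  ⊥ᶠ ⊤ᶠ : Formula
  _≐ʷ_ : WTerm → WTerm → Formula
  _≐ˢ_ : ℕ → ℕ → Formula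
  _∈ᶠ_ : WTerm → ℕ → Formula
  _∧ᶠ_ _∨ᶠ_ _⇒ᶠ_ : Formula → Formula → Formula
  ¬ᶠ_ : Formula → Formula
  ∀ʷ ∃ʷ ∀ˢ ∃ˢ : Formula → Formula

record Structure : Set₁ where
  field
    Word   : Set
    System : Set
    𝟘 𝟙    : Word
    _·_    : Word → Word → Word
    _∈_    : Word → System → Set

module Semantics (St : Structure) where
  open Structure St

  evalT : (ℕ → Word) → WTerm → Word
  evalT ρ (wvar n) = ρ n
  evalT ρ c0 = 𝟘
  evalT ρ c1 = 𝟙
  evalT ρ (t ·ᵗ u) = evalT ρ t · evalT ρ u

  ⟦_⟧ : Formula → (ℕ → Word) → (ℕ → System) → Set
  ⟦ ⊥ᶠ ⟧ ρ σ = ⊥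
  ⟦ ⊤ᶠ ⟧ ρ σ = ⊤
  ⟦ t ≐ʷ u ⟧ ρ σ = evalT ρ t ≡ evalT ρ u
  ⟦ i ≐ˢ j ⟧ ρ σ = σ i ≡ σ j
  ⟦ t ∈ᶠ i ⟧ ρ σ = evalT ρ t ∈ σ i
  ⟦ φ ∧ᶠ ψ ⟧ ρ σ = ⟦ φ ⟧ ρ σ × ⟦ ψ ⟧ ρ σ
  ⟦ φ ∨ᶠ ψ ⟧ ρ σ = ⟦ φ ⟧ ρ σ ⊎ ⟦ ψ ⟧ ρ σ
  ⟦ φ ⇒ᶠ ψ ⟧ ρ σ = ⟦ φ ⟧ ρ σ → ⟦ ψ ⟧ ρ σ
  ⟦ ¬ᶠ φ ⟧ ρ σ = ¬ ⟦ φ ⟧ ρ σ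
  ⟦ ∀ʷ φ ⟧ ρ σ = (x : Word) → ⟦ φ ⟧ (x ∷ᵉ ρ) σ
  ⟦ ∃ʷ φ ⟧ ρ σ = Σ Word (λ x → ⟦ φ ⟧ (x ∷ᵉ ρ) σ)
  ⟦ ∀ˢ φ ⟧ ρ σ = (X : System) → ⟦ φ ⟧ ρ (X ∷ᵉ σ)
  ⟦ ∃ˢ φ ⟧ ρ σ = Σ System (λ X → ⟦ φ ⟧ ρ (X ∷ᵉ σ))

record Model : Set₁ where
  field
    structure : Structure
  open Structure structure public
  open Semantics structure public
  field
    0≢1        : ¬ (𝟘 ≡ 𝟙)
    ·≢0        : ∀ x y → ¬ (x · y ≡ 𝟘)
    ·≢1        : ∀ x y → ¬ (x · y ≡ 𝟙)
    assoc      : ∀ x y z → (x · y) · z ≡ x · (y · z)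
    reading    : ∀ x y → ¬ (x · 𝟘 ≡ y · 𝟙)
    simplify   : ∀ x₁ y₁ x₂ y₂ → x₁ · y₁ ≡ x₂ · y₂ → y₁ ≡ y₂ → x₁ ≡ x₂
    ext        : ∀ (A B : System) → (∀ x → (x ∈ A → x ∈ B) × (x ∈ B → x ∈ A)) → A ≡ B
    wordInd    : ∀ (A : System) → 𝟘 ∈ A → 𝟙 ∈ A
                 → (∀ x → x ∈ A → (x · 𝟘) ∈ A)
                 → (∀ x → x ∈ A → (x · 𝟙) ∈ A)
                 → ∀ x → x ∈ A
    -- comprehension: for every formula φ (word variable 0 plays the role of x,
    -- the other variables are parameters given by the environments; the new
    -- system S is not among them, so it is not free in φ)
    comprehension : ∀ (φ : Formula) (ρ : ℕ → Word) (σ : ℕ → System)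
                    → Σ System (λ S → ∀ x → (x ∈ S → ⟦ φ ⟧ (x ∷ᵉ ρ) σ)
                                             × (⟦ φ ⟧ (x ∷ᵉ ρ) σ → x ∈ S))

module _ (M : Model) where
  open Model M

  _⊆_ : System → System → Set
  A ⊆ B = ∀ x → x ∈ A → x ∈ B

  RightClosed : System → System → Set
  RightClosed S T = S ⊆ T × (∀ x₁ x₂ → x₁ ∈ S → x₂ ∈ T → (x₂ · x₁) ∈ T)

  LeftClosed : System → System → Set
  LeftClosed S T = S ⊆ T × (∀ x₁ x₂ → x₁ ∈ S → x₂ ∈ T → (x₁ · x₂) ∈ T)

  RightGenerated : System → System → Set
  RightGenerated S₁ S = RightClosed S S₁ × (∀ T → RightClosed S T → S₁ ⊆ T)

  LeftGenerated : System → System → Set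
  LeftGenerated S₂ S = LeftClosed S S₂ × (∀ T → LeftClosed S T → S₂ ⊆ T)

module Submission where

-- Both S₁ (right-generated) and S₂ (left-generated) are minimal, so it
-- suffices to show that each of them also enjoys the other closure property:
-- then S₁ ⊆ S₂ by minimality of S₁, S₂ ⊆ S₁ by minimality of S₂, and
-- extensionality gives S₁ = S₂.
--
-- To see that the left-generated T is also right-closed, form by
-- comprehension its right quotient by S,
--     T / S = { y | y z ∈ T for every z ∈ S }.
-- Using associativity, T / S is again left-closed over S, so minimality gives
-- T ⊆ T / S, which says precisely that T is right-closed.  The mirror argument
-- uses the left quotient  S ∖ T = { y | z y ∈ T for every z ∈ S }.

open import Defs
open import Relation.Binary.PropositionalEquality using (_≡_; subst; sym)
open import Data.Product using (Σ; _×_; _,_; proj₁; proj₂)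

module _ (M : Model) where
  open Model M

  -- Comprehension instance for a formula whose free system variables 0 and 1
  -- denote S and T, and which has no free word parameters besides x.
  comprehend₂ : (φ : Formula) (S T : System)
    → Σ System λ Q → ∀ y → (y ∈ Q → ⟦ φ ⟧ (y ∷ᵉ λ _ → 𝟘) (S ∷ᵉ (T ∷ᵉ λ _ → S)))
                          × (⟦ φ ⟧ (y ∷ᵉ λ _ → 𝟘) (S ∷ᵉ (T ∷ᵉ λ _ → S)) → y ∈ Q)
  comprehend₂ φ S T = comprehension φ (λ _ → 𝟘) (S ∷ᵉ (T ∷ᵉ λ _ → S))

  rightQuotient : (S T : System)
    → Σ System λ Q → ∀ y → (y ∈ Q → ∀ z → z ∈ S → (y · z) ∈ T)
                          × ((∀ z → z ∈ S → (y · z) ∈ T) → y ∈ Q)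
  rightQuotient = comprehend₂ (∀ʷ ((wvar 0 ∈ᶠ 0) ⇒ᶠ ((wvar 1 ·ᵗ wvar 0) ∈ᶠ 1)))

  leftQuotient : (S T : System)
    → Σ System λ Q → ∀ y → (y ∈ Q → ∀ z → z ∈ S → (z · y) ∈ T)
                          × ((∀ z → z ∈ S → (z · y) ∈ T) → y ∈ Q)
  leftQuotient = comprehend₂ (∀ʷ ((wvar 0 ∈ᶠ 0) ⇒ᶠ ((wvar 0 ·ᵗ wvar 1) ∈ᶠ 1)))

  -- If T is left-closed over S, so is its right quotient T / S:
  -- s ∈ S gives s z ∈ T for z ∈ S, and (x₁ x₂) z = x₁ (x₂ z) ∈ T.
  rightQuotient-leftClosed : ∀ S T → LeftClosed M S T
    → LeftClosed M S (proj₁ (rightQuotient S T))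
  rightQuotient-leftClosed S T (S⊆T , leftStep) = contains-S , quotient-step
    where
    open Σ (rightQuotient S T) renaming (proj₁ to Q; proj₂ to Q-spec)

    contains-S : ∀ s → s ∈ S → s ∈ Q
    contains-S s s∈S = proj₂ (Q-spec s) λ z z∈S → leftStep s z s∈S (S⊆T z z∈S)

    quotient-step : ∀ x₁ x₂ → x₁ ∈ S → x₂ ∈ Q → (x₁ · x₂) ∈ Q
    quotient-step x₁ x₂ x₁∈S x₂∈Q = proj₂ (Q-spec (x₁ · x₂)) λ z z∈S →
      subst (_∈ T) (sym (assoc x₁ x₂ z))
            (leftStep x₁ (x₂ · z) x₁∈S (proj₁ (Q-spec x₂) x₂∈Q z z∈S))

  leftQuotient-rightClosed : ∀ S T → RightClosed M S T
    → RightClosed M S (proj₁ (leftQuotient S T))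
  leftQuotient-rightClosed S T (S⊆T , rightStep) = contains-S , quotient-step
    where
    open Σ (leftQuotient S T) renaming (proj₁ to Q; proj₂ to Q-spec)

    contains-S : ∀ s → s ∈ S → s ∈ Q
    contains-S s s∈S = proj₂ (Q-spec s) λ z z∈S → rightStep s z s∈S (S⊆T z z∈S)

    quotient-step : ∀ x₁ x₂ → x₁ ∈ S → x₂ ∈ Q → (x₂ · x₁) ∈ Q
    quotient-step x₁ x₂ x₁∈S x₂∈Q = proj₂ (Q-spec (x₂ · x₁)) λ z z∈S →
      subst (_∈ T) (assoc z x₂ x₁)
            (rightStep x₁ (z · x₂) x₁∈S (proj₁ (Q-spec x₂) x₂∈Q z z∈S))

  -- A left-generated system is also right-closed: it is contained in its
  -- right quotient by minimality.
  leftGenerated-rightClosed : ∀ S T → LeftGenerated M T S → RightClosed M S T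
  leftGenerated-rightClosed S T (closed , minimal) =
    proj₁ closed , λ x₁ x₂ x₁∈S x₂∈T →
      proj₁ (proj₂ (rightQuotient S T) x₂)
            (minimal _ (rightQuotient-leftClosed S T closed) x₂ x₂∈T) x₁ x₁∈S

  rightGenerated-leftClosed : ∀ S T → RightGenerated M T S → LeftClosed M S T
  rightGenerated-leftClosed S T (closed , minimal) =
    proj₁ closed , λ x₁ x₂ x₁∈S x₂∈T →
      proj₁ (proj₂ (leftQuotient S T) x₂)
            (minimal _ (leftQuotient-rightClosed S T closed) x₂ x₂∈T) x₁ x₁∈S

mainTheorem16 : (M : Model) (S S₁ S₂ : Model.System M)
                → RightGenerated M S₁ S → LeftGenerated M S₂ S → S₁ ≡ S₂
mainTheorem16 M S S₁ S₂ right@(_ , S₁-minimal) left@(_ , S₂-minimal) =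
  Model.ext M S₁ S₂ λ x → S₁⊆S₂ x , S₂⊆S₁ x
  where
  S₁⊆S₂ : _⊆_ M S₁ S₂
  S₁⊆S₂ = S₁-minimal S₂ (leftGenerated-rightClosed M S S₂ left)

  S₂⊆S₁ : _⊆_ M S₂ S₁
  S₂⊆S₁ = S₂-minimal S₁ (rightGenerated-leftClosed M S S₁ right)
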